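{- Suppose there exists a $\mu$-way $1$-solely balanced set with block size $k\ge2$, volume $m$ and foundation size $v$, such that $k=\frac{v}{m}$. Then $\mu\le\frac{v-1}{k-1}$. Moreover, the equality $\mu=\frac{v-1}{k-1}$ holds when there exists an $RB(v,k,1)$.
   Context: For integers $\mu\ge 2$, $k>t\ge1$, a $\mu$-way $(v,k,t)$ trade of volume $m$ consists of $\mu$ pairwise disjoint collections $T_1,\dots,T_\mu$, each of $m$ blocks ($k$-subsets of a $v$-set $V$), such that every $t$-subset of $V$ is contained in the same number of blocks in each $T_i$. Its foundation $\mathrm{found}(T)$ is the set of points covered by the blocks. It is a Steiner trade if every $t$-subset of $\mathrm{found}(T)$ occurs in at most one block of each $T_i$. A $\mu$-way $1$-solely balanced set is a $\mu$-way $(v,k,1)$ Steiner trade such that no block of $T_j$ and block of $T_b$ with $j\ne b$ share more than one element; its foundation size is $|\mathrm{found}(T)|$. An $RB(v,k,1)$ is a resolvable $2$-$(v,k,1)$ design (every pair of points of a $v$-set lies in exactly one block of size $k$, and the blocks partition into parallel classes, each a partition of the point set). -}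

module Defs where

open import Data.Nat using (ℕ; zero; suc; _+_; _*_; _∸_; _≤_; _<_)
open import Data.Fin using (Fin; zero; suc)
open import Data.Fin.Subset using (Subset; _∈_; _∩_; ∣_∣; ⋃)
open import Data.Fin.Subset.Properties using (_∈?_)
open import Data.List using (List; []; _∷_; concat; map; allFin)
import Data.List.Membership.Propositional
open import Data.Product using (Σ; _×_)
open import Relation.Nullary using (¬_; yes; no)
open import Relation.Binary.PropositionalEquality using (_≡_; _≢_)

countIn : ∀ {n m} → Fin n → (Fin m → Subset n) → ℕ
countIn {m = zero}  x B = 0
countIn {m = suc m} x B with x ∈? B zero
... | yes _ = suc (countIn x (λ j → B (suc j)))
... | no  _ = countIn x (λ j → B (suc j))

-- A μ-way trade T of volume m with blocks in the point set Fin n: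
-- T i j is the j-th block of the i-th collection T_i.
Trade : ℕ → ℕ → ℕ → Set
Trade μ m n = Fin μ → Fin m → Subset n

found : ∀ {μ m n} → Trade μ m n → Subset n
found {μ} {m} T = ⋃ (concat (map (λ i → map (T i) (allFin m)) (allFin μ)))

IsTrade1 : (μ k m n : ℕ) → Trade μ m n → Set
IsTrade1 μ k m n T =
  (2 ≤ μ) × (1 < k) × (1 ≤ m)
  × (∀ i j → ∣ T i j ∣ ≡ k)
  × (∀ i i' → i ≢ i' → ∀ j j' → T i j ≢ T i' j')
  -- every 1-subset {x} lies in the same number of blocks of each T_i
  × (∀ x i i' → countIn x (T i) ≡ countIn x (T i'))

IsSteiner1 : ∀ {μ m n} → Trade μ m n → Set
IsSteiner1 T = ∀ i j j' x → x ∈ T i j → x ∈ T i j' → j ≡ j'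

IsSolelyBalanced : (μ k m n : ℕ) → Trade μ m n → Set
IsSolelyBalanced μ k m n T =
  IsTrade1 μ k m n T × IsSteiner1 T
  × (∀ i i' → i ≢ i' → ∀ j j' → ∣ T i j ∩ T i' j' ∣ ≤ 1)

ExistsSBS : (μ k m v : ℕ) → Set
ExistsSBS μ k m v =
  Σ ℕ λ n → Σ (Trade μ m n) λ T → IsSolelyBalanced μ k m n T × (∣ found T ∣ ≡ v)

countPt : ∀ {n} → Fin n → List (Subset n) → ℕ
countPt x [] = 0
countPt x (B ∷ Bs) with x ∈? B
... | yes _ = suc (countPt x Bs)
... | no  _ = countPt x Bs

countPair : ∀ {n} → Fin n → Fin n → List (Subset n) → ℕ
countPair x y [] = 0
countPair x y (B ∷ Bs) with x ∈? B | y ∈? B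
... | yes _ | yes _ = suc (countPair x y Bs)
... | _     | _     = countPair x y Bs

-- A resolvable 2-(v,k,1) design RB(v,k,1) on the point set Fin v, given by
-- its list of parallel classes (each a list of blocks); the blocks of the
-- design are all blocks of all classes.
IsRB : (v k : ℕ) → List (List (Subset v)) → Set
IsRB v k classes =
  (∀ {P} → P Data.List.Membership.Propositional.∈ classes →
     ∀ {B} → B Data.List.Membership.Propositional.∈ P → ∣ B ∣ ≡ k)
  × (∀ {P} → P Data.List.Membership.Propositional.∈ classes → ∀ x → countPt x P ≡ 1)
  × (∀ x y → x ≢ y → countPair x y (concat classes) ≡ 1)

ExistsRB : (v k : ℕ) → Set
ExistsRB v k = Σ (List (List (Subset v))) (IsRB v k)

-- All counting is done with 0/1 indicators χ p of subsets p and finite sums ∑ over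
-- Fin n (the standard library's semiring sums, instantiated at ℕ), via ∣ p ∣ = ∑ χ p.
--
-- Upper bound (a sunflower argument).  Balance puts a point x of one block into a
-- block B i of every collection T i; blocks of different collections share at most
-- one point, so the petals B i ∖ {x} are disjoint inside found T ∖ {x}.
--
-- Equality.  The r parallel classes of an RB(v,k,1) form an r-way trade (module
-- FromResolvableDesign): every class has m = v / k blocks; balance and the Steiner
-- property hold because each class partitions the points; blocks of different
-- classes meet at most once because every pair lies in a unique block.  Counting the
-- pairs through a fixed point in two ways gives r k = r + (v - 1).
--
-- The main theorem combines the two parts; the bound forces m ≥ 2, hence r ≥ 2.

module Submission where

open import Data.Nat using (ℕ; zero; suc; _+_; _*_; _∸_; _≤_; z≤n; s≤s; _≤?_; >-nonZero)
open import Data.Nat.Properties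
open import Data.Bool using (true; false; if_then_else_)
open import Data.Fin using (Fin; zero; suc; punchIn; cast; fromℕ<) renaming (_≟_ to _≟ᶠ_)
open import Data.Fin.Properties using (punchInᵢ≢i; cast-is-id) renaming (suc-injective to Fin-suc-injective)
open import Data.Fin.Subset using (Subset; _∈_; _∉_; _⊆_; _∩_; ∣_∣; ⋃; ⊤)
open import Data.Fin.Subset.Properties
  using (_∈?_; x∈p∪q⁺; x∈p∩q⁺; x∈p∩q⁻; ∩-idem; ⊆⊤; ⊆-antisym; ∣⊤∣≡n)
open import Data.Vec using ([]; _∷_; lookup)
open import Data.Vec.Properties using ([]=⇒lookup; lookup⇒[]=)
open import Data.List using (List; []; _∷_; _++_; concat; map; allFin; length)
import Data.List as List
open import Data.List.Membership.Propositional using () renaming (_∈_ to _∈ₗ_)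
open import Data.List.Membership.Propositional.Properties using (∈-map⁺; ∈-concat⁺′; ∈-allFin; ∈-lookup)
open import Data.List.Relation.Unary.Any using (here; there)
open import Data.Product using (Σ; ∃; _×_; _,_; proj₁; proj₂)
open import Data.Sum using (inj₁; inj₂)
open import Relation.Nullary using (yes; no; contradiction)
open import Relation.Binary.PropositionalEquality
open import Function using (_∘_)
open import Algebra.Properties.Semiring.Sum +-*-semiring
  using (sum; sum-syntax; sum-cong-≗; ∑-comm; sum-remove; *-distribˡ-sum; *-distribʳ-sum)
open import Defs

sum-const : ∀ n c → ∑[ i < n ] c ≡ n * c
sum-const zero    c = refl
sum-const (suc n) c = cong (c +_) (sum-const n c)

sum-mono : ∀ {n} {f g : Fin n → ℕ} → (∀ i → f i ≤ g i) → sum f ≤ sum g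
sum-mono {zero}  f≤g = z≤n
sum-mono {suc n} f≤g = +-mono-≤ (f≤g zero) (sum-mono (λ i → f≤g (suc i)))

term≤sum : ∀ {n} (f : Fin n → ℕ) i → f i ≤ sum f
term≤sum f zero    = m≤m+n _ _
term≤sum f (suc i) = ≤-trans (term≤sum (λ j → f (suc j)) i) (m≤n+m _ _)

two-terms≤sum : ∀ {n} (f : Fin n → ℕ) {i i'} → i ≢ i' → f i + f i' ≤ sum f
two-terms≤sum f {zero}  {zero}   i≢i' = contradiction refl i≢i'
two-terms≤sum f {zero}  {suc i'} _    = +-monoʳ-≤ (f zero) (term≤sum (λ j → f (suc j)) i')
two-terms≤sum f {suc i} {zero}   _    =
  subst (_≤ sum f) (+-comm (f zero) (f (suc i))) (+-monoʳ-≤ (f zero) (term≤sum (λ j → f (suc j)) i))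
two-terms≤sum f {suc i} {suc i'} i≢i' =
  ≤-trans (two-terms≤sum (λ j → f (suc j)) (λ i≡i' → i≢i' (cong suc i≡i'))) (m≤n+m _ _)

sum-cast : ∀ {a b} (e : a ≡ b) (f : Fin b → ℕ) → ∑[ j < a ] f (cast e j) ≡ sum f
sum-cast refl f = sum-cong-≗ (λ j → cong f (cast-is-id refl j))

two-positive-terms : ∀ {n} (f : Fin n → ℕ) {i i'} → i ≢ i' → 1 ≤ f i → 1 ≤ f i' → 2 ≤ sum f
two-positive-terms f i≢i' 1≤fᵢ 1≤fᵢ' = ≤-trans (+-mono-≤ 1≤fᵢ 1≤fᵢ') (two-terms≤sum f i≢i')

sum-pos : ∀ {n} (f : Fin n → ℕ) → 1 ≤ sum f → ∃ λ j → 1 ≤ f j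
sum-pos {suc n} f 1≤Σ with 1 ≤? f zero
... | yes 1≤f₀ = zero , 1≤f₀
... | no  1≰f₀ with sum-pos (λ j → f (suc j)) (subst (λ a → 1 ≤ a + sum (λ j → f (suc j))) (n<1⇒n≡0 (≰⇒> 1≰f₀)) 1≤Σ)
...   | j , 1≤fj = suc j , 1≤fj

sum≤1 : ∀ {n} (f : Fin n → ℕ) → (∀ i → f i ≤ 1) →
        (∀ i i' → 1 ≤ f i → 1 ≤ f i' → i ≡ i') → sum f ≤ 1
sum≤1 {zero}  f f≤1 unique = z≤n
sum≤1 {suc n} f f≤1 unique with 1 ≤? f zero
... | no 1≰f₀ = subst (λ a → a + sum (λ j → f (suc j)) ≤ 1) (sym (n<1⇒n≡0 (≰⇒> 1≰f₀)))
                  (sum≤1 (λ j → f (suc j)) (λ i → f≤1 (suc i)) (λ i i' p q → Fin-suc-injective (unique _ _ p q)))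
... | yes 1≤f₀ = +-mono-≤ (f≤1 zero) rest≤0
  where
  rest-zero : ∀ i → f (suc i) ≤ 0
  rest-zero i = ≤-pred (≰⇒> λ 1≤fᵢ → contradiction (unique zero (suc i) 1≤f₀ 1≤fᵢ) λ ())
  rest≤0 : sum (λ j → f (suc j)) ≤ 0
  rest≤0 = ≤-trans (sum-mono {g = λ _ → 0} rest-zero) (≤-reflexive (trans (sum-const n 0) (*-zeroʳ n)))

χ : ∀ {n} → Subset n → Fin n → ℕ
χ p x = if lookup p x then 1 else 0

χ-∈ : ∀ {n} {p : Subset n} {x} → x ∈ p → χ p x ≡ 1
χ-∈ x∈p rewrite []=⇒lookup x∈p = refl

χ-∉ : ∀ {n} {p : Subset n} {x} → x ∉ p → χ p x ≡ 0
χ-∉ {p = p} {x} x∉p with lookup p x in eq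
... | true  = contradiction (lookup⇒[]= x p eq) x∉p
... | false = refl

χ≤1 : ∀ {n} (p : Subset n) x → χ p x ≤ 1
χ≤1 p x with lookup p x
... | true  = s≤s z≤n
... | false = z≤n

χ-pos : ∀ {n} {p : Subset n} {x} → 1 ≤ χ p x → x ∈ p
χ-pos {p = p} {x} _ with lookup p x in eq
... | true = lookup⇒[]= x p eq

χ-idem : ∀ {n} (p : Subset n) x → χ p x * χ p x ≡ χ p x
χ-idem p x with lookup p x
... | true  = refl
... | false = refl

card-sum : ∀ {n} (p : Subset n) → ∣ p ∣ ≡ sum (χ p)
card-sum []          = refl
card-sum (true ∷ p)  = cong suc (card-sum p)
card-sum (false ∷ p) = card-sum p

card-split : ∀ {n} {p : Subset (suc n)} {x} → x ∈ p → ∣ p ∣ ≡ suc (∑[ j < n ] χ p (punchIn x j))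
card-split {n} {p} {x} x∈p = begin
  ∣ p ∣                                 ≡⟨ card-sum p ⟩
  sum (χ p)                             ≡⟨ sum-remove {i = x} (χ p) ⟩
  χ p x + ∑[ j < n ] χ p (punchIn x j)  ≡⟨ cong (_+ ∑[ j < n ] χ p (punchIn x j)) (χ-∈ x∈p) ⟩
  suc (∑[ j < n ] χ p (punchIn x j))    ∎
  where open ≡-Reasoning

two-members : ∀ {n} {p : Subset n} {x y} → x ≢ y → x ∈ p → y ∈ p → 2 ≤ ∣ p ∣
two-members {p = p} x≢y x∈p y∈p = subst (2 ≤_) (sym (card-sum p))
  (two-positive-terms (χ p) x≢y (≤-reflexive (sym (χ-∈ x∈p))) (≤-reflexive (sym (χ-∈ y∈p))))

card≤1 : ∀ {n} {p : Subset n} → (∀ {x y} → x ∈ p → y ∈ p → x ≡ y) → ∣ p ∣ ≤ 1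
card≤1 {p = p} unique = subst (_≤ 1) (sym (card-sum p))
  (sum≤1 (χ p) (χ≤1 p) (λ x y 1≤χx 1≤χy → unique (χ-pos 1≤χx) (χ-pos 1≤χy)))

nonempty : ∀ {n} {p : Subset n} → 1 ≤ ∣ p ∣ → ∃ λ x → x ∈ p
nonempty {p = p} 1≤∣p∣ with sum-pos (χ p) (subst (1 ≤_) (card-sum p) 1≤∣p∣)
... | x , 1≤χ = x , χ-pos 1≤χ

bounded-by-indicator : ∀ {a b} → a ≤ 1 → (1 ≤ a → 1 ≤ b) → a ≤ b
bounded-by-indicator {zero}  _         _    = z≤n
bounded-by-indicator {suc _} (s≤s z≤n) pos⇒ = pos⇒ (s≤s z≤n)

-- If μ sets of size k all contain x, lie inside C, and pairwise
-- meet in at most one point, then their petals A i ∖ {x} are disjoint in C ∖ {x}: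
-- every point y ≢ x is counted by at most one petal, and only if y ∈ C.
sunflower-bound : ∀ {μ n k} (A : Fin μ → Subset n) (C : Subset n) (x : Fin n) →
  (∀ i → x ∈ A i) → (∀ i → A i ⊆ C) → (∀ i → ∣ A i ∣ ≡ k) →
  (∀ i i' → i ≢ i' → ∣ A i ∩ A i' ∣ ≤ 1) → μ * (k ∸ 1) ≤ ∣ C ∣ ∸ 1
sunflower-bound {zero}              _ _ _ _   _   _   _    = z≤n
sunflower-bound {suc μ} {suc n} {k} A C x x∈A A⊆C ∣A∣ meet = begin
  suc μ * (k ∸ 1)                                  ≡⟨ sum-const (suc μ) (k ∸ 1) ⟨
  ∑[ i < suc μ ] (k ∸ 1)                           ≡⟨ sum-cong-≗ petal-size ⟩
  ∑[ i < suc μ ] ∑[ j < n ] χ (A i) (punchIn x j)  ≡⟨ ∑-comm (λ i j → χ (A i) (punchIn x j)) ⟩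
  ∑[ j < n ] ∑[ i < suc μ ] χ (A i) (punchIn x j)  ≤⟨ sum-mono (λ j → in-one-petal (punchIn x j) (punchInᵢ≢i x j)) ⟩
  ∑[ j < n ] χ C (punchIn x j)                     ≡⟨ cong (_∸ 1) (card-split (A⊆C zero (x∈A zero))) ⟨
  ∣ C ∣ ∸ 1                                        ∎
  where
  open ≤-Reasoning
  petal-size : ∀ i → k ∸ 1 ≡ ∑[ j < n ] χ (A i) (punchIn x j)
  petal-size i = cong (_∸ 1) (trans (sym (∣A∣ i)) (card-split (x∈A i)))
  in-one-petal : ∀ y → y ≢ x → ∑[ i < suc μ ] χ (A i) y ≤ χ C y
  in-one-petal y y≢x = bounded-by-indicator (sum≤1 (λ i → χ (A i) y) (λ i → χ≤1 (A i) y) unique) in-C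
    where
    unique : ∀ i i' → 1 ≤ χ (A i) y → 1 ≤ χ (A i') y → i ≡ i'
    unique i i' 1≤χᵢ 1≤χᵢ' with i ≟ᶠ i'
    ... | yes i≡i' = i≡i'
    ... | no  i≢i' = contradiction (meet i i' i≢i')
          (<⇒≱ (two-members y≢x (x∈p∩q⁺ (χ-pos 1≤χᵢ , χ-pos 1≤χᵢ')) (x∈p∩q⁺ (x∈A i , x∈A i'))))
    in-C : 1 ≤ ∑[ i < suc μ ] χ (A i) y → 1 ≤ χ C y
    in-C 1≤Σ with sum-pos (λ i → χ (A i) y) 1≤Σ
    ... | i , 1≤χᵢ = ≤-reflexive (sym (χ-∈ (A⊆C i (χ-pos 1≤χᵢ))))

countIn-sum : ∀ {n m} (x : Fin n) (B : Fin m → Subset n) → countIn x B ≡ ∑[ j < m ] χ (B j) x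
countIn-sum {m = zero}  x B = refl
countIn-sum {m = suc m} x B with x ∈? B zero
... | yes x∈B₀ rewrite χ-∈ x∈B₀ = cong suc (countIn-sum x (λ j → B (suc j)))
... | no  x∉B₀ rewrite χ-∉ x∉B₀ = countIn-sum x (λ j → B (suc j))

∈-⋃ : ∀ {n} {x : Fin n} {p} {ps : List (Subset n)} → x ∈ p → p ∈ₗ ps → x ∈ ⋃ ps
∈-⋃ x∈p (here refl) = x∈p∪q⁺ (inj₁ x∈p)
∈-⋃ x∈p (there p∈ps) = x∈p∪q⁺ (inj₂ (∈-⋃ x∈p p∈ps))

block⊆found : ∀ {μ m n} (T : Trade μ m n) i j → T i j ⊆ found T
block⊆found {μ} {m} T i j x∈Tᵢⱼ =
  ∈-⋃ x∈Tᵢⱼ (∈-concat⁺′ (∈-map⁺ (T i) (∈-allFin j)) (∈-map⁺ (λ i → map (T i) (allFin m)) (∈-allFin i)))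

-- In a μ-way (n,k,1) trade a point of the first block lies in some block of every
-- collection, because all collections cover it equally often.
common-point : ∀ {μ k m n} {T : Trade μ m n} → IsTrade1 μ k m n T →
               ∃ λ x → ∀ i → ∃ λ j → x ∈ T i j
common-point {suc μ} {k} {suc m} {n} {T} (_ , 1<k , _ , ∣T∣ , _ , balanced) = x , block-through-x
  where
  T₀₀-inhabited : ∃ λ x → x ∈ T zero zero
  T₀₀-inhabited = nonempty (subst (1 ≤_) (sym (∣T∣ zero zero)) (<⇒≤ 1<k))
  x : Fin n
  x = proj₁ T₀₀-inhabited
  x∈T₀ : 1 ≤ countIn x (T zero)
  x∈T₀ = subst (1 ≤_) (sym (countIn-sum x (T zero)))
           (≤-trans (≤-reflexive (sym (χ-∈ (proj₂ T₀₀-inhabited)))) (term≤sum (λ j → χ (T zero j) x) zero))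
  block-through-x : ∀ i → ∃ λ j → x ∈ T i j
  block-through-x i with sum-pos (λ j → χ (T i j) x) (subst (1 ≤_) (trans (balanced x zero i) (countIn-sum x (T i))) x∈T₀)
  ... | j , 1≤χ = j , χ-pos 1≤χ

-- First part of the theorem: the blocks through a common point form a sunflower
-- inside the foundation.
solely-balanced-bound : ∀ {μ k m n} {T : Trade μ m n} → IsSolelyBalanced μ k m n T →
                        μ * (k ∸ 1) ≤ ∣ found T ∣ ∸ 1
solely-balanced-bound {μ} {k} {m} {n} {T} (trade@(_ , _ , _ , ∣T∣ , _ , _) , _ , meet)
  with common-point trade
... | x , through-x = sunflower-bound B (found T) x (λ i → proj₂ (through-x i))
        (λ i → block⊆found T i (j i)) (λ i → ∣T∣ i (j i)) (λ i i' i≢i' → meet i i' i≢i' (j i) (j i'))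
  where
  j : Fin μ → Fin m
  j i = proj₁ (through-x i)
  B : Fin μ → Subset n
  B i = T i (j i)

countPt-sum : ∀ {n} (x : Fin n) (P : List (Subset n)) →
              countPt x P ≡ ∑[ j < length P ] χ (List.lookup P j) x
countPt-sum x []      = refl
countPt-sum x (B ∷ P) with x ∈? B
... | yes x∈B rewrite χ-∈ x∈B = cong suc (countPt-sum x P)
... | no  x∉B rewrite χ-∉ x∉B = countPt-sum x P

countPair-sum : ∀ {n} (x y : Fin n) (P : List (Subset n)) →
                countPair x y P ≡ ∑[ j < length P ] (χ (List.lookup P j) x * χ (List.lookup P j) y)
countPair-sum x y []      = refl
countPair-sum x y (B ∷ P) with x ∈? B | y ∈? B
... | yes x∈B | yes y∈B rewrite χ-∈ x∈B | χ-∈ y∈B = cong suc (countPair-sum x y P)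
... | yes x∈B | no  y∉B rewrite χ-∈ x∈B | χ-∉ y∉B = countPair-sum x y P
... | no  x∉B | _       rewrite χ-∉ x∉B = countPair-sum x y P

countPair-++ : ∀ {n} (x y : Fin n) (P Q : List (Subset n)) →
               countPair x y (P ++ Q) ≡ countPair x y P + countPair x y Q
countPair-++ x y []      Q = refl
countPair-++ x y (B ∷ P) Q with x ∈? B | y ∈? B
... | yes _ | yes _ = cong suc (countPair-++ x y P Q)
... | yes _ | no  _ = countPair-++ x y P Q
... | no  _ | _     = countPair-++ x y P Q

countPair-concat : ∀ {n} (x y : Fin n) (L : List (List (Subset n))) →
                   countPair x y (concat L) ≡ ∑[ i < length L ] countPair x y (List.lookup L i)
countPair-concat x y []      = refl
countPair-concat x y (P ∷ L) = trans (countPair-++ x y P (concat L)) (cong (countPair x y P +_) (countPair-concat x y L))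

class-size : ∀ {v k} {P : List (Subset v)} → (∀ {B} → B ∈ₗ P → ∣ B ∣ ≡ k) →
             (∀ x → countPt x P ≡ 1) → length P * k ≡ v
class-size {v} {k} {P} ∣B∣ partition = begin
  length P * k                                       ≡⟨ sum-const (length P) k ⟨
  ∑[ j < length P ] k                                ≡⟨ sum-cong-≗ (λ j → trans (sym (∣B∣ (∈-lookup {xs = P} j))) (card-sum (List.lookup P j))) ⟩
  ∑[ j < length P ] ∑[ x < v ] χ (List.lookup P j) x  ≡⟨ ∑-comm (λ j x → χ (List.lookup P j) x) ⟩
  ∑[ x < v ] ∑[ j < length P ] χ (List.lookup P j) x  ≡⟨ sum-cong-≗ (λ x → trans (sym (countPt-sum x P)) (partition x)) ⟩
  ∑[ x < v ] 1                                       ≡⟨ sum-const v 1 ⟩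
  v * 1                                              ≡⟨ *-identityʳ v ⟩
  v                                                  ∎
  where open ≡-Reasoning

subtract-replication : ∀ r k w → 1 ≤ k → r * k ≡ r + w → r * (k ∸ 1) ≡ w
subtract-replication r (suc k) w _ rk≡r+w = +-cancelˡ-≡ r _ _ (trans (sym (*-suc r k)) rk≡r+w)

at-least-two-classes : ∀ {r k m} → 2 ≤ k → 2 ≤ m → r * (k ∸ 1) ≡ k * m ∸ 1 → 2 ≤ r
at-least-two-classes {r} {k@(suc _)} {m} _ 2≤m replication = ≰⇒> λ r≤1 → <-irrefl refl (begin-strict
  k * m ∸ 1      ≡⟨ replication ⟨
  r * (k ∸ 1)    ≤⟨ *-monoˡ-≤ (k ∸ 1) r≤1 ⟩
  1 * (k ∸ 1)    ≡⟨ *-identityˡ (k ∸ 1) ⟩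
  k ∸ 1          <⟨ ∸-monoˡ-< (m<m*n k m 2≤m) (s≤s z≤n) ⟩
  k * m ∸ 1      ∎)
  where open ≤-Reasoning

-- The bound of the first part forces volume m ≥ 2: with m = 1 it would read
-- μ (k - 1) ≤ k - 1 although μ ≥ 2 and k ≥ 2.
at-least-two-blocks : ∀ {μ k m} → 2 ≤ μ → 2 ≤ k → 1 ≤ m → μ * (k ∸ 1) ≤ k * m ∸ 1 → 2 ≤ m
at-least-two-blocks {k = suc zero} _ (s≤s ()) _ _
at-least-two-blocks {μ} {k@(suc (suc _))} {m} 2≤μ _ 1≤m bound = ≰⇒> λ m≤1 → <-irrefl refl (begin-strict
  k ∸ 1          <⟨ m<m+n (k ∸ 1) (s≤s z≤n) ⟩
  2 * (k ∸ 1)    ≤⟨ *-monoˡ-≤ (k ∸ 1) 2≤μ ⟩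
  μ * (k ∸ 1)    ≤⟨ bound ⟩
  k * m ∸ 1      ≡⟨ cong (λ m → k * m ∸ 1) (≤-antisym m≤1 1≤m) ⟩
  k * 1 ∸ 1      ≡⟨ cong (_∸ 1) (*-identityʳ k) ⟩
  k ∸ 1          ∎)
  where open ≤-Reasoning

module FromResolvableDesign {n k m : ℕ} (2≤k : 2 ≤ k) (2≤m : 2 ≤ m) (km≡1+n : k * m ≡ suc n)
  (classes : List (List (Subset (suc n)))) (rb : IsRB (suc n) k classes) where

  block-size : ∀ {P} → P ∈ₗ classes → ∀ {B} → B ∈ₗ P → ∣ B ∣ ≡ k
  block-size = proj₁ rb

  is-parallel : ∀ {P} → P ∈ₗ classes → ∀ x → countPt x P ≡ 1
  is-parallel = proj₁ (proj₂ rb)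

  pair-in-one-block : ∀ x y → x ≢ y → countPair x y (concat classes) ≡ 1
  pair-in-one-block = proj₂ (proj₂ rb)

  r : ℕ
  r = length classes

  class : Fin r → List (Subset (suc n))
  class = List.lookup classes

  -- Every class has exactly m blocks, so its blocks can be indexed by Fin m.
  class-length : ∀ i → m ≡ length (class i)
  class-length i = *-cancelʳ-≡ m (length (class i)) k {{>-nonZero (≤-trans (s≤s z≤n) 2≤k)}}
    (trans (*-comm m k) (trans km≡1+n (sym (class-size (block-size (∈-lookup i)) (is-parallel (∈-lookup i))))))

  T : Trade r m (suc n)
  T i j = List.lookup (class i) (cast (class-length i) j)

  ∣T∣ : ∀ i j → ∣ T i j ∣ ≡ k
  ∣T∣ i j = block-size (∈-lookup i) (∈-lookup (cast (class-length i) j))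

  cover : ∀ x i → ∑[ j < m ] χ (T i j) x ≡ 1
  cover x i = trans (sum-cast (class-length i) (λ j → χ (List.lookup (class i) j) x))
                    (trans (sym (countPt-sum x (class i))) (is-parallel (∈-lookup i) x))

  pairs : Fin (suc n) → Fin (suc n) → ℕ
  pairs x y = ∑[ i < r ] ∑[ j < m ] (χ (T i j) x * χ (T i j) y)

  pairs-once : ∀ {x y} → x ≢ y → pairs x y ≡ 1
  pairs-once {x} {y} x≢y = begin
    pairs x y                                   ≡⟨ sum-cong-≗ (λ i → sum-cast (class-length i) _) ⟩
    ∑[ i < r ] ∑[ j < length (class i) ] (χ (List.lookup (class i) j) x * χ (List.lookup (class i) j) y)
                                                ≡⟨ sum-cong-≗ (λ i → countPair-sum x y (class i)) ⟨
    ∑[ i < r ] countPair x y (class i)          ≡⟨ countPair-concat x y classes ⟨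
    countPair x y (concat classes)              ≡⟨ pair-in-one-block x y x≢y ⟩
    1                                           ∎
    where open ≡-Reasoning

  -- Counting the blocks through x paired with a second point y, sorted by y:
  -- y = x contributes one block per class, every other y exactly one block.
  pairs-through-by-points : ∀ (x : Fin (suc n)) → ∑[ y < suc n ] pairs x y ≡ r + n
  pairs-through-by-points x = begin
    ∑[ y < suc n ] pairs x y                        ≡⟨ sum-remove {i = x} (pairs x) ⟩
    pairs x x + ∑[ j < n ] pairs x (punchIn x j)    ≡⟨ cong₂ _+_ diagonal others ⟩
    r + n                                           ∎
    where
    open ≡-Reasoning
    diagonal : pairs x x ≡ r
    diagonal = trans (sum-cong-≗ (λ i → trans (sum-cong-≗ (λ j → χ-idem (T i j) x)) (cover x i)))
                        (trans (sum-const r 1) (*-identityʳ r))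
    others : ∑[ j < n ] pairs x (punchIn x j) ≡ n
    others = trans (sum-cong-≗ (λ j → pairs-once (punchInᵢ≢i x j ∘ sym)))
                   (trans (sum-const n 1) (*-identityʳ n))

  -- Counting the same quantity by blocks: each of the r blocks through x (one per
  -- class) has k points.
  pairs-through-by-blocks : ∀ (x : Fin (suc n)) → ∑[ y < suc n ] pairs x y ≡ r * k
  pairs-through-by-blocks x = begin
    ∑[ y < suc n ] ∑[ i < r ] ∑[ j < m ] (χ (T i j) x * χ (T i j) y)
      ≡⟨ ∑-comm (λ y i → ∑[ j < m ] (χ (T i j) x * χ (T i j) y)) ⟩
    ∑[ i < r ] ∑[ y < suc n ] ∑[ j < m ] (χ (T i j) x * χ (T i j) y)
      ≡⟨ sum-cong-≗ (λ i → ∑-comm (λ y j → χ (T i j) x * χ (T i j) y)) ⟩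
    ∑[ i < r ] ∑[ j < m ] ∑[ y < suc n ] (χ (T i j) x * χ (T i j) y)
      ≡⟨ sum-cong-≗ (λ i → sum-cong-≗ (λ j → *-distribˡ-sum (χ (T i j) x) (χ (T i j)))) ⟨
    ∑[ i < r ] ∑[ j < m ] (χ (T i j) x * sum (χ (T i j)))
      ≡⟨ sum-cong-≗ (λ i → sum-cong-≗ (λ j → cong (χ (T i j) x *_) (trans (sym (card-sum (T i j))) (∣T∣ i j)))) ⟩
    ∑[ i < r ] ∑[ j < m ] (χ (T i j) x * k)
      ≡⟨ sum-cong-≗ (λ i → *-distribʳ-sum k (λ j → χ (T i j) x)) ⟨
    ∑[ i < r ] (∑[ j < m ] χ (T i j) x * k)
      ≡⟨ sum-cong-≗ (λ i → trans (cong (_* k) (cover x i)) (*-identityˡ k)) ⟩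
    ∑[ i < r ] k
      ≡⟨ sum-const r k ⟩
    r * k ∎
    where open ≡-Reasoning

  replication : r * (k ∸ 1) ≡ n
  replication = subtract-replication r k n (≤-trans (s≤s z≤n) 2≤k)
    (trans (sym (pairs-through-by-blocks zero)) (pairs-through-by-points zero))

  at-least-two : 2 ≤ r
  at-least-two = at-least-two-classes 2≤k 2≤m (trans replication (cong (_∸ 1) (sym km≡1+n)))

  in-one-block-per-class : IsSteiner1 T
  in-one-block-per-class i j j' x x∈Tᵢⱼ x∈Tᵢⱼ' with j ≟ᶠ j'
  ... | yes j≡j' = j≡j'
  ... | no  j≢j' = contradiction (cover x i)
        (>⇒≢ (two-positive-terms (λ j → χ (T i j) x) j≢j' (≤-reflexive (sym (χ-∈ x∈Tᵢⱼ))) (≤-reflexive (sym (χ-∈ x∈Tᵢⱼ')))))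

  pair-in-block : ∀ {x y} i j → x ∈ T i j → y ∈ T i j → 1 ≤ ∑[ j < m ] (χ (T i j) x * χ (T i j) y)
  pair-in-block {x} {y} i j x∈Tᵢⱼ y∈Tᵢⱼ =
    ≤-trans (≤-reflexive (sym (cong₂ _*_ (χ-∈ x∈Tᵢⱼ) (χ-∈ y∈Tᵢⱼ)))) (term≤sum (λ j → χ (T i j) x * χ (T i j) y) j)

  -- Blocks of different classes share at most one point, since otherwise two
  -- points would lie in two blocks.
  meet-at-most-once : ∀ i i' → i ≢ i' → ∀ j j' → ∣ T i j ∩ T i' j' ∣ ≤ 1
  meet-at-most-once i i' i≢i' j j' = card≤1 same
    where
    same : ∀ {y y'} → y ∈ T i j ∩ T i' j' → y' ∈ T i j ∩ T i' j' → y ≡ y'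
    same {y} {y'} y∈ y'∈ with y ≟ᶠ y' | x∈p∩q⁻ (T i j) (T i' j') y∈ | x∈p∩q⁻ (T i j) (T i' j') y'∈
    ... | yes y≡y' | _ | _ = y≡y'
    ... | no  y≢y' | y∈Tᵢⱼ , y∈Tᵢ'ⱼ' | y'∈Tᵢⱼ , y'∈Tᵢ'ⱼ' = contradiction (pairs-once y≢y')
          (>⇒≢ (two-positive-terms (λ i → ∑[ j < m ] (χ (T i j) y * χ (T i j) y')) i≢i'
                 (pair-in-block i j y∈Tᵢⱼ y'∈Tᵢⱼ) (pair-in-block i' j' y∈Tᵢ'ⱼ' y'∈Tᵢ'ⱼ')))

  -- Different classes share no block: a common block would meet itself in k ≥ 2
  -- points.
  classes-disjoint : ∀ i i' → i ≢ i' → ∀ j j' → T i j ≢ T i' j'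
  classes-disjoint i i' i≢i' j j' Tᵢⱼ≡Tᵢ'ⱼ' = contradiction (meet-at-most-once i i' i≢i' j j') (<⇒≱ (begin-strict
    1                       <⟨ 2≤k ⟩
    k                       ≡⟨ ∣T∣ i j ⟨
    ∣ T i j ∣               ≡⟨ cong ∣_∣ (∩-idem (T i j)) ⟨
    ∣ T i j ∩ T i j ∣       ≡⟨ cong (λ B → ∣ T i j ∩ B ∣) Tᵢⱼ≡Tᵢ'ⱼ' ⟩
    ∣ T i j ∩ T i' j' ∣     ∎))
    where open ≤-Reasoning

  balanced : ∀ x i i' → countIn x (T i) ≡ countIn x (T i')
  balanced x i i' = trans (countIn-sum x (T i)) (trans (cover x i) (sym (trans (countIn-sum x (T i')) (cover x i'))))

  in-some-block : ∀ i y → ∃ λ j → y ∈ T i j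
  in-some-block i y with sum-pos (λ j → χ (T i j) y) (≤-reflexive (sym (cover y i)))
  ... | j , 1≤χ = j , χ-pos 1≤χ

  found-everything : ∣ found T ∣ ≡ suc n
  found-everything = trans (cong ∣_∣ (⊆-antisym {i = found T} {j = ⊤} ⊆⊤ (λ {y} _ → covered y))) (∣⊤∣≡n (suc n))
    where
    i₀ : Fin r
    i₀ = fromℕ< (≤-trans (s≤s z≤n) at-least-two)
    covered : ∀ y → y ∈ found T
    covered y = block⊆found T i₀ (proj₁ (in-some-block i₀ y)) (proj₂ (in-some-block i₀ y))

  solely-balanced : IsSolelyBalanced r k m (suc n) T
  solely-balanced = (at-least-two , 2≤k , ≤-trans (s≤s z≤n) 2≤m , ∣T∣ , classes-disjoint , balanced)
                  , in-one-block-per-class , meet-at-most-once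

rb⇒solely-balanced : ∀ {k m v} → 2 ≤ k → 2 ≤ m → k * m ≡ v → ExistsRB v k →
                     Σ ℕ λ μ' → ExistsSBS μ' k m v × (μ' * (k ∸ 1) ≡ v ∸ 1)
rb⇒solely-balanced {suc _} {suc _} {zero} _ _ () _
rb⇒solely-balanced {v = suc n} 2≤k 2≤m km≡1+n (classes , rb) =
  r , (suc n , T , solely-balanced , found-everything) , replication
  where open FromResolvableDesign 2≤k 2≤m km≡1+n classes rb

-- Main theorem: the bound is solely-balanced-bound on the foundation of size v;
-- it also yields m ≥ 2, which the construction from an RB design needs.
mainTheorem2 : (μ k m v : ℕ) → 2 ≤ k → k * m ≡ v → ExistsSBS μ k m v →
    (μ * (k ∸ 1) ≤ v ∸ 1)
    × (ExistsRB v k → Σ ℕ λ μ' → ExistsSBS μ' k m v × (μ' * (k ∸ 1) ≡ v ∸ 1))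
mainTheorem2 μ k m v 2≤k km≡v (n , T , sbs@((2≤μ , _ , 1≤m , _) , _) , ∣found∣≡v) =
  bound , rb⇒solely-balanced 2≤k 2≤m km≡v
  where
  bound : μ * (k ∸ 1) ≤ v ∸ 1
  bound = subst (λ w → μ * (k ∸ 1) ≤ w ∸ 1) ∣found∣≡v (solely-balanced-bound sbs)
  2≤m : 2 ≤ m
  2≤m = at-least-two-blocks 2≤μ 2≤k 1≤m (subst (λ w → μ * (k ∸ 1) ≤ w ∸ 1) (sym km≡v) bound)
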